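{- Let $n\ge3$ be an odd integer. Then the cycle $C_n$ admits an optimal extended irregular dominating set if and only if there exists a strong starter in $\mathbb{Z}_n$.
   Context: $C_n$ is the cycle of length $n$. For a graph $\Gamma=(V,E)$ with distance $d$: a vertex $v$ carrying a positive integer label $\ell$ dominates exactly the vertices $u$ with $d(u,v)=\ell$; a vertex carrying label $0$ dominates only itself. A $k$-extended irregular dominating set is a set $S\subseteq V$ of $k$ vertices with an injective labeling $\lambda:S\to\{0,1,2,\dots\}$ such that every vertex of $V$ is dominated by some vertex of $S$, where some vertex of $S$ has label $0$; $\gamma_e(\Gamma)$ is the minimum such $k$, and the set is optimal if $k=\gamma_e(\Gamma)$. For an additive abelian group $G$ of odd order $g$, a starter in $G$ is a set of unordered pairs $\{\{x_i,y_i\}:1\le i\le (g-1)/2\}$ such that $\{x_i,y_i:1\le i\le (g-1)/2\}=G\setminus\{0\}$ and $\{\pm(x_i-y_i):1\le i\le (g-1)/2\}=G\setminus\{0\}$. It is a strong starter if moreover the sums $x_i+y_i$, $1\le i\le (g-1)/2$, are pairwise distinct and all nonzero. -}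

module Defs where

open import Data.Nat using (ℕ; zero; suc; _+_; _∸_; _≤_; _⊓_; ∣_-_∣; _/_; _%_)
open import Data.Fin using (Fin; toℕ)
open import Data.Product using (Σ; ∃; ∃-syntax; _×_; _,_)
open import Data.Sum using (_⊎_)
open import Relation.Binary.PropositionalEquality using (_≡_; _≢_)
open import Function.Definitions using (Injective)
open import Function.Bundles using (_⇔_)

-- The cycle C_n : vertex set Fin n, vertex i adjacent to i ± 1 (mod n).
-- Graph distance in C_n between i and j is min(|i-j|, n-|i-j|).

cycleDist : (n : ℕ) → Fin n → Fin n → ℕ
cycleDist n a b = ∣ toℕ a - toℕ b ∣ ⊓ (n ∸ ∣ toℕ a - toℕ b ∣)

Dominates : (n : ℕ) → Fin n → ℕ → Fin n → Set
Dominates n v zero    u = u ≡ v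
Dominates n v (suc ℓ) u = cycleDist n u v ≡ suc ℓ

IsEIDSet : (n k : ℕ) → (Fin k → Fin n) → (Fin k → ℕ) → Set
IsEIDSet n k v lab =
  Injective _≡_ _≡_ v ×
  Injective _≡_ _≡_ lab ×
  (∃[ i ] lab i ≡ 0) ×
  (∀ (u : Fin n) → ∃[ i ] Dominates n (v i) (lab i) u)

HasEIDSet : (n k : ℕ) → Set
HasEIDSet n k = Σ (Fin k → Fin n) λ v → Σ (Fin k → ℕ) λ lab → IsEIDSet n k v lab

HasOptimalEIDSet : ℕ → Set
HasOptimalEIDSet n =
  ∃[ k ] (HasEIDSet n k × (∀ k′ → HasEIDSet n k′ → k ≤ k′))

addMod : (n : ℕ) → Fin n → Fin n → ℕ
addMod zero    a b = 0
addMod (suc p) a b = (toℕ a + toℕ b) % suc p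

subMod : (n : ℕ) → Fin n → Fin n → ℕ
subMod zero    a b = 0
subMod (suc p) a b = (toℕ a + (suc p ∸ toℕ b)) % suc p

-- A starter in ℤ_n (n odd): (n-1)/2 unordered pairs {x i, y i}
-- (given by an ordered representative) whose elements are exactly
-- the nonzero elements and whose differences ±(x i - y i) are exactly
-- the nonzero elements.
IsStarter : (n : ℕ) → (Fin ((n ∸ 1) / 2) → Fin n) → (Fin ((n ∸ 1) / 2) → Fin n) → Set
IsStarter n x y =
  (∀ (a : Fin n) → (∃[ i ] (x i ≡ a ⊎ y i ≡ a)) ⇔ (toℕ a ≢ 0)) ×
  (∀ (a : Fin n) →
     (∃[ i ] (toℕ a ≡ subMod n (x i) (y i) ⊎ toℕ a ≡ subMod n (y i) (x i)))
     ⇔ (toℕ a ≢ 0))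

IsStrongStarter : (n : ℕ) → (Fin ((n ∸ 1) / 2) → Fin n) → (Fin ((n ∸ 1) / 2) → Fin n) → Set
IsStrongStarter n x y =
  IsStarter n x y ×
  (∀ i j → addMod n (x i) (y i) ≡ addMod n (x j) (y j) → i ≡ j) ×
  (∀ i → addMod n (x i) (y i) ≢ 0)

HasStrongStarter : ℕ → Set
HasStrongStarter n =
  Σ (Fin ((n ∸ 1) / 2) → Fin n) λ x → Σ (Fin ((n ∸ 1) / 2) → Fin n) λ y → IsStrongStarter n x y

-- Write n = 2M + 1. A vertex with label r ≥ 1 dominates exactly the two vertices at distance r,
-- and no vertex lies at distance more than M. So in an extended irregular dominating set every
-- vertex u occupies one of n slots relative to its dominator: the dominator itself (label 0) or
-- one side at distance r ∈ {1, …, M}. Labels are distinct, so the slot determines the dominator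
-- and hence u; counting, every slot is occupied. Thus every label 0, …, M is used (so at least
-- M + 1 vertices are needed), and if c carries label 0 and w_r carries label r, the pairs
-- {w_r − r − c, w_r + r − c} cover the nonzero residues, have differences ±2r, and have sums
-- 2(w_r − c) that are distinct and nonzero because 2 is invertible modulo n: a strong starter.
-- Conversely, the difference of each pair {x, y} of a strong starter is ±2r for exactly one
-- r ∈ {1, …, M}; the midpoint m with 2m = x + y dominates x and y with label r, and distinct
-- nonzero sums give distinct nonzero midpoints, so 0 (label 0) and the midpoints form an
-- extended irregular dominating set with M + 1 vertices.

module Submission where

open import Defs
open import Data.Nat
  using (ℕ; zero; suc; _+_; _*_; _∸_; _≤_; _<_; s≤s; z<s; _⊓_; ∣_-_∣; _%_; _/_; ⌊_/2⌋; ⌈_/2⌉; _≤?_)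
open import Data.Nat.Properties
open import Data.Nat.DivMod
open import Data.Nat.Tactic.RingSolver using (solve-∀)
open import Data.Fin using (Fin; zero; suc; toℕ; fromℕ<; punchOut; splitAt; _↑ˡ_; _↑ʳ_; cast)
import Data.Fin.Properties as Fin
open import Data.Product using (∃; ∃-syntax; _×_; _,_; proj₁; proj₂; map₂)
open import Data.Sum as Sum using (_⊎_; inj₁; inj₂; [_,_]′)
open import Data.Empty using (⊥-elim)
open import Relation.Nullary using (yes; no)
open import Relation.Binary.PropositionalEquality
open import Relation.Binary.Bundles using (Setoid)
import Relation.Binary.Reasoning.Setoid as SetoidReasoning
open import Function.Definitions using (Injective; StrictlySurjective)
open import Function.Bundles using (_⇔_; mk⇔; Equivalence)
open import Function.Base using (_$_; _∘_)
open import Algebra.Properties.CommutativeSemigroup +-commutativeSemigroup using (interchange)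

injective⇒strictlySurjective : ∀ {m n} {f : Fin m → Fin n} → n ≤ m →
                               Injective _≡_ _≡_ f → StrictlySurjective _≡_ f
injective⇒strictlySurjective {n = zero} _ _ ()
injective⇒strictlySurjective {n = suc _} {f} n≤m f-inj y with Fin.any? (λ x → f x Fin.≟ y)
... | yes hit = hit
... | no miss = ⊥-elim (1+n≰n (≤-trans n≤m (Fin.injective⇒≤ punchOut∘f-injective)))
  where
  avoids : ∀ x → y ≢ f x
  avoids x y≡fx = miss (x , sym y≡fx)
  punchOut∘f-injective : Injective _≡_ _≡_ (λ x → punchOut (avoids x))
  punchOut∘f-injective {a} {b} eq = f-inj (Fin.punchOut-injective (avoids a) (avoids b) eq)

strictlySurjective⇒injective : ∀ {m n} {f : Fin m → Fin n} → m ≤ n →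
                               StrictlySurjective _≡_ f → Injective _≡_ _≡_ f
strictlySurjective⇒injective {m} {n} {f} m≤n f-surj {a} {b} fa≡fb = begin
  a               ≡⟨ section∘f a ⟨
  section (f a)   ≡⟨ cong section fa≡fb ⟩
  section (f b)   ≡⟨ section∘f b ⟩
  b               ∎
  where
  open ≡-Reasoning
  section : Fin n → Fin m
  section = proj₁ ∘ f-surj
  f∘section : ∀ y → f (section y) ≡ y
  f∘section = proj₂ ∘ f-surj
  section-injective : Injective _≡_ _≡_ section
  section-injective {y} {z} eq = trans (sym (f∘section y)) (trans (cong f eq) (f∘section z))
  section∘f : ∀ x → section (f x) ≡ x
  section∘f x with x₀ , refl ← injective⇒strictlySurjective m≤n section-injective x =
    cong section (f∘section x₀)

m*2≡m+m : ∀ m → m * 2 ≡ m + m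
m*2≡m+m m = trans (*-comm m 2) (cong (m +_) (+-identityʳ m))

attains-below⇒≤ : ∀ {m k} (f : Fin k → ℕ) → (∀ (x : Fin m) → ∃[ i ] f i ≡ toℕ x) → m ≤ k
attains-below⇒≤ f attains = Fin.injective⇒≤ {f = proj₁ ∘ attains} λ {x} {y} eq →
  Fin.toℕ-injective (trans (sym (proj₂ (attains x))) (trans (cong f eq) (proj₂ (attains y))))

m+m≡n+n⇒m≡n : ∀ {m n} → m + m ≡ n + n → m ≡ n
m+m≡n+n⇒m≡n {m} {n} eq = trans (n≡⌊n+n/2⌋ m) (trans (cong ⌊_/2⌋ eq) (sym (n≡⌊n+n/2⌋ n)))

m+m≢1+n+n : ∀ m n → m + m ≢ suc (n + n)
m+m≢1+n+n m n eq = <-irrefl (trans (sym m≡n) m≡1+n) (n<1+n n)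
  where
  m≡n : m ≡ n
  m≡n = trans (n≡⌊n+n/2⌋ m) (trans (cong ⌊_/2⌋ eq) (sym (n≡⌈n+n/2⌉ n)))
  m≡1+n : m ≡ suc n
  m≡1+n = trans (n≡⌈n+n/2⌉ m) (trans (cong ⌈_/2⌉ eq) (cong suc (sym (n≡⌊n+n/2⌋ n))))

even⊎odd : ∀ a → (∃[ q ] a ≡ q + q) ⊎ (∃[ q ] a ≡ suc (q + q))
even⊎odd zero = inj₁ (0 , refl)
even⊎odd (suc a) with even⊎odd a
... | inj₁ (q , refl) = inj₂ (q , refl)
... | inj₂ (q , refl) = inj₁ (suc q , cong suc (sym (+-suc q q)))

module Residues (N : ℕ) where

  n : ℕ
  n = suc N

  -- A record rather than an abbreviation, so that a and b can be inferred from a ≋ b.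
  infix 4 _≋_
  record _≋_ (a b : ℕ) : Set where
    constructor mk≋
    field mod≡ : a % n ≡ b % n
  open _≋_ public

  ≋-setoid : Setoid _ _
  ≋-setoid = record
    { Carrier       = ℕ
    ; _≈_           = _≋_
    ; isEquivalence = record
      { refl  = mk≋ refl
      ; sym   = λ (mk≋ e) → mk≋ (sym e)
      ; trans = λ (mk≋ e) (mk≋ f) → mk≋ (trans e f)
      }
    }
  open Setoid ≋-setoid public using () renaming (refl to ≋-refl; sym to ≋-sym; trans to ≋-trans)
  open SetoidReasoning ≋-setoid

  _⊕_ _⊖_ : ℕ → ℕ → ℕ
  a ⊕ d = (a + d) % n
  a ⊖ d = (a + (n ∸ d)) % n

  ⊕<n : ∀ a d → a ⊕ d < n
  ⊕<n a d = m%n<n (a + d) n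

  ⊖<n : ∀ a d → a ⊖ d < n
  ⊖<n a d = m%n<n (a + (n ∸ d)) n

  %-≋ : ∀ a → a % n ≋ a
  %-≋ a = mk≋ (m%n%n≡m%n a n)

  +n-≋ : ∀ a → a + n ≋ a
  +n-≋ a = mk≋ ([m+n]%n≡m%n a n)

  +-cong-≋ : ∀ {a a′ b b′} → a ≋ a′ → b ≋ b′ → a + b ≋ a′ + b′
  +-cong-≋ {a} {a′} {b} {b′} (mk≋ a≋a′) (mk≋ b≋b′) = mk≋ $
    trans (%-distribˡ-+ a b n)
          (trans (cong₂ (λ x y → (x + y) % n) a≋a′ b≋b′) (sym (%-distribˡ-+ a′ b′ n)))

  +-congˡ-≋ : ∀ a {b b′} → b ≋ b′ → a + b ≋ a + b′
  +-congˡ-≋ a = +-cong-≋ ≋-refl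

  +-congʳ-≋ : ∀ {a a′} b → a ≋ a′ → a + b ≋ a′ + b
  +-congʳ-≋ b a≋a′ = +-cong-≋ a≋a′ ≋-refl

  *-congˡ-≋ : ∀ k {a b} → a ≋ b → k * a ≋ k * b
  *-congˡ-≋ k {a} {b} (mk≋ a≋b) = mk≋ $
    trans (%-distribˡ-* k a n) (trans (cong (λ x → (k % n * x) % n) a≋b) (sym (%-distribˡ-* k b n)))

  ≋⇒≡ : ∀ {a b} → a < n → b < n → a ≋ b → a ≡ b
  ≋⇒≡ a<n b<n (mk≋ a≋b) = trans (sym (m<n⇒m%n≡m a<n)) (trans a≋b (m<n⇒m%n≡m b<n))

  [a⊖b]+b≋a : ∀ a {b} → b ≤ n → (a ⊖ b) + b ≋ a
  [a⊖b]+b≋a a {b} b≤n = begin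
    (a ⊖ b) + b       ≈⟨ +-congʳ-≋ b (%-≋ (a + (n ∸ b))) ⟩
    a + (n ∸ b) + b   ≡⟨ +-assoc a (n ∸ b) b ⟩
    a + (n ∸ b + b)   ≡⟨ cong (a +_) (m∸n+n≡m b≤n) ⟩
    a + n             ≈⟨ +n-≋ a ⟩
    a                 ∎

  +-cancelʳ-≋ : ∀ {a b c} → c ≤ n → a + c ≋ b + c → a ≋ b
  +-cancelʳ-≋ {a} {b} {c} c≤n a+c≋b+c = begin
    a                  ≈⟨ +n-≋ a ⟨
    a + n              ≡⟨ undo a ⟨
    a + c + (n ∸ c)    ≈⟨ +-congʳ-≋ (n ∸ c) a+c≋b+c ⟩
    b + c + (n ∸ c)    ≡⟨ undo b ⟩
    b + n              ≈⟨ +n-≋ b ⟩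
    b                  ∎
    where
    undo : ∀ x → x + c + (n ∸ c) ≡ x + n
    undo x = trans (+-assoc x c (n ∸ c)) (cong (x +_) (m+[n∸m]≡n c≤n))

  ≡⇒≋ : ∀ {a b} → a ≡ b → a ≋ b
  ≡⇒≋ a≡b = mk≋ (cong (_% n) a≡b)

  ⊖-unique : ∀ a {b t} → b ≤ n → t < n → t + b ≋ a → a ⊖ b ≡ t
  ⊖-unique a {b} {t} b≤n t<n t+b≋a =
    ≋⇒≡ (⊖<n a b) t<n (+-cancelʳ-≋ b≤n (≋-trans ([a⊖b]+b≋a a b≤n) (≋-sym t+b≋a)))

  [a⊕d]⊖d≡a : ∀ {a d} → a < n → d ≤ n → (a ⊕ d) ⊖ d ≡ a
  [a⊕d]⊖d≡a {a} {d} a<n d≤n = ⊖-unique (a ⊕ d) d≤n a<n (≋-sym (%-≋ (a + d)))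

  [a⊖d]⊕d≡a : ∀ {a d} → a < n → d ≤ n → (a ⊖ d) ⊕ d ≡ a
  [a⊖d]⊕d≡a {a} a<n d≤n = trans (mod≡ ([a⊖b]+b≋a a d≤n)) (m<n⇒m%n≡m a<n)

  [a⊕d]⊖a≡d : ∀ {a d} → a < n → d < n → (a ⊕ d) ⊖ a ≡ d
  [a⊕d]⊖a≡d {a} {d} a<n d<n = ⊖-unique (a ⊕ d) (<⇒≤ a<n) d<n (begin
    d + a   ≡⟨ +-comm d a ⟩
    a + d   ≈⟨ %-≋ (a + d) ⟨
    a ⊕ d   ∎)

  a⊖a≡0 : ∀ {a} → a < n → a ⊖ a ≡ 0
  a⊖a≡0 {a} a<n = ⊖-unique a (<⇒≤ a<n) z<s ≋-refl

  a⊖[a⊖b]≡b : ∀ a {b} → b < n → a ⊖ (a ⊖ b) ≡ b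
  a⊖[a⊖b]≡b a {b} b<n = ⊖-unique a (<⇒≤ (⊖<n a b)) b<n (begin
    b + (a ⊖ b)   ≡⟨ +-comm b (a ⊖ b) ⟩
    (a ⊖ b) + b   ≈⟨ [a⊖b]+b≋a a (<⇒≤ b<n) ⟩
    a             ∎)

  ⊖-cancelʳ : ∀ {a b c} → a < n → b < n → c ≤ n → a ⊖ c ≡ b ⊖ c → a ≡ b
  ⊖-cancelʳ {a} {b} {c} a<n b<n c≤n a⊖c≡b⊖c = ≋⇒≡ a<n b<n (begin
    a             ≈⟨ [a⊖b]+b≋a a c≤n ⟨
    (a ⊖ c) + c   ≡⟨ cong (_+ c) a⊖c≡b⊖c ⟩
    (b ⊖ c) + c   ≈⟨ [a⊖b]+b≋a b c≤n ⟩
    b             ∎)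

  ⊖≡0⇒≡ : ∀ {a b} → a < n → b < n → a ⊖ b ≡ 0 → a ≡ b
  ⊖≡0⇒≡ a<n b<n a⊖b≡0 = ⊖-cancelʳ a<n b<n (<⇒≤ b<n) (trans a⊖b≡0 (sym (a⊖a≡0 b<n)))

  b⊖a≡n∸[a⊖b] : ∀ {a b} → a < n → b < n → a ⊖ b ≢ 0 → b ⊖ a ≡ n ∸ (a ⊖ b)
  b⊖a≡n∸[a⊖b] {a} {b} a<n b<n a⊖b≢0 = ⊖-unique b (<⇒≤ a<n) n∸t<n (begin
    n ∸ t + a         ≈⟨ +-congˡ-≋ (n ∸ t) ([a⊖b]+b≋a a (<⇒≤ b<n)) ⟨
    n ∸ t + (t + b)   ≡⟨ +-assoc (n ∸ t) t b ⟨
    n ∸ t + t + b     ≡⟨ cong (_+ b) (m∸n+n≡m (<⇒≤ (⊖<n a b))) ⟩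
    n + b             ≡⟨ +-comm n b ⟩
    b + n             ≈⟨ +n-≋ b ⟩
    b                 ∎)
    where
    t : ℕ
    t = a ⊖ b
    n∸t<n : n ∸ t < n
    n∸t<n = ∸-monoʳ-< (n≢0⇒n>0 a⊖b≢0) (<⇒≤ (⊖<n a b))

  ⊖-⊖-comm : ∀ a {b c} → b ≤ n → c ≤ n → (a ⊖ b) ⊖ c ≡ (a ⊖ c) ⊖ b
  ⊖-⊖-comm a {b} {c} b≤n c≤n = ⊖-unique (a ⊖ b) c≤n (⊖<n (a ⊖ c) b) (+-cancelʳ-≋ b≤n (begin
    (a ⊖ c) ⊖ b + c + b   ≡⟨ +-assoc ((a ⊖ c) ⊖ b) c b ⟩
    (a ⊖ c) ⊖ b + (c + b) ≡⟨ cong (((a ⊖ c) ⊖ b) +_) (+-comm c b) ⟩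
    (a ⊖ c) ⊖ b + (b + c) ≡⟨ +-assoc ((a ⊖ c) ⊖ b) b c ⟨
    (a ⊖ c) ⊖ b + b + c   ≈⟨ +-congʳ-≋ c ([a⊖b]+b≋a (a ⊖ c) b≤n) ⟩
    (a ⊖ c) + c           ≈⟨ [a⊖b]+b≋a a c≤n ⟩
    a                     ≈⟨ [a⊖b]+b≋a a b≤n ⟨
    (a ⊖ b) + b           ∎))

  ⊕-⊖-comm : ∀ a b {c} → c ≤ n → (a ⊕ b) ⊖ c ≡ (a ⊖ c) ⊕ b
  ⊕-⊖-comm a b {c} c≤n = ⊖-unique (a ⊕ b) c≤n (⊕<n (a ⊖ c) b) (begin
    (a ⊖ c) ⊕ b + c     ≈⟨ +-congʳ-≋ c (%-≋ ((a ⊖ c) + b)) ⟩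
    (a ⊖ c) + b + c     ≡⟨ +-assoc (a ⊖ c) b c ⟩
    (a ⊖ c) + (b + c)   ≡⟨ cong ((a ⊖ c) +_) (+-comm b c) ⟩
    (a ⊖ c) + (c + b)   ≡⟨ +-assoc (a ⊖ c) c b ⟨
    (a ⊖ c) + c + b     ≈⟨ +-congʳ-≋ b ([a⊖b]+b≋a a c≤n) ⟩
    a + b               ≈⟨ %-≋ (a + b) ⟨
    a ⊕ b               ∎)

  [m⊕d]⊖[m⊖d]≡d+d : ∀ m {d} → d + d < n → (m ⊕ d) ⊖ (m ⊖ d) ≡ d + d
  [m⊕d]⊖[m⊖d]≡d+d m {d} 2d<n = ⊖-unique (m ⊕ d) (<⇒≤ (⊖<n m d)) 2d<n (begin
    d + d + (m ⊖ d)     ≡⟨ +-assoc d d (m ⊖ d) ⟩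
    d + (d + (m ⊖ d))   ≡⟨ cong (d +_) (+-comm d (m ⊖ d)) ⟩
    d + ((m ⊖ d) + d)   ≈⟨ +-congˡ-≋ d ([a⊖b]+b≋a m d≤n) ⟩
    d + m               ≡⟨ +-comm d m ⟩
    m + d               ≈⟨ %-≋ (m + d) ⟨
    m ⊕ d               ∎)
    where
    d≤n : d ≤ n
    d≤n = ≤-trans (m≤m+n d d) (<⇒≤ 2d<n)

  [m⊖d]+[m⊕d]≋m+m : ∀ m {d} → d ≤ n → (m ⊖ d) + (m ⊕ d) ≋ m + m
  [m⊖d]+[m⊕d]≋m+m m {d} d≤n = begin
    (m ⊖ d) + (m ⊕ d)   ≈⟨ +-congˡ-≋ (m ⊖ d) (%-≋ (m + d)) ⟩
    (m ⊖ d) + (m + d)   ≡⟨ cong ((m ⊖ d) +_) (+-comm m d) ⟩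
    (m ⊖ d) + (d + m)   ≡⟨ +-assoc (m ⊖ d) d m ⟨
    (m ⊖ d) + d + m     ≈⟨ +-congʳ-≋ m ([a⊖b]+b≋a m d≤n) ⟩
    m + m               ∎

  q⊖p≡d+d⇒[p⊕d]⊕d≡q : ∀ {p q d} → p < n → q < n → q ⊖ p ≡ d + d → (p ⊕ d) ⊕ d ≡ q
  q⊖p≡d+d⇒[p⊕d]⊕d≡q {p} {q} {d} p<n q<n q⊖p≡2d = ≋⇒≡ (⊕<n (p ⊕ d) d) q<n (begin
    (p ⊕ d) ⊕ d     ≈⟨ %-≋ ((p ⊕ d) + d) ⟩
    (p ⊕ d) + d     ≈⟨ +-congʳ-≋ d (%-≋ (p + d)) ⟩
    p + d + d       ≡⟨ +-assoc p d d ⟩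
    p + (d + d)     ≡⟨ +-comm p (d + d) ⟩
    (d + d) + p     ≡⟨ cong (_+ p) q⊖p≡2d ⟨
    (q ⊖ p) + p     ≈⟨ [a⊖b]+b≋a q (<⇒≤ p<n) ⟩
    q               ∎)

module CycleDistance (N : ℕ) where

  open Residues N

  dist : ℕ → ℕ → ℕ
  dist a b = ∣ a - b ∣ ⊓ (n ∸ ∣ a - b ∣)

  dist-comm : ∀ a b → dist a b ≡ dist b a
  dist-comm a b = cong (λ t → t ⊓ (n ∸ t)) (∣-∣-comm a b)

  dist≡⊖⊓⊖-≥ : ∀ {a b} → a < n → b < n → b ≤ a → dist a b ≡ (a ⊖ b) ⊓ (b ⊖ a)
  dist≡⊖⊓⊖-≥ {a} {b} a<n b<n b≤a = begin
    dist a b                  ≡⟨ cong (λ t → t ⊓ (n ∸ t)) (m≤n⇒∣n-m∣≡n∸m b≤a) ⟩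
    (a ∸ b) ⊓ (n ∸ (a ∸ b))   ≡⟨ cong (λ t → t ⊓ (n ∸ t)) a⊖b≡a∸b ⟨
    (a ⊖ b) ⊓ (n ∸ (a ⊖ b))   ≡⟨ agree (a ⊖ b) (b⊖a≡n∸[a⊖b] a<n b<n) ⟩
    (a ⊖ b) ⊓ (b ⊖ a)         ∎
    where
    open ≡-Reasoning
    a⊖b≡a∸b : a ⊖ b ≡ a ∸ b
    a⊖b≡a∸b = ⊖-unique a (<⇒≤ b<n) (≤-<-trans (m∸n≤m a b) a<n) (≡⇒≋ (m∸n+n≡m b≤a))
    agree : ∀ t {s} → (t ≢ 0 → s ≡ n ∸ t) → t ⊓ (n ∸ t) ≡ t ⊓ s
    agree zero    _      = refl
    agree (suc t) s≡n∸t = cong (suc t ⊓_) (sym (s≡n∸t λ ()))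

  dist≡⊖⊓⊖ : ∀ {a b} → a < n → b < n → dist a b ≡ (a ⊖ b) ⊓ (b ⊖ a)
  dist≡⊖⊓⊖ {a} {b} a<n b<n with ≤-total b a
  ... | inj₁ b≤a = dist≡⊖⊓⊖-≥ a<n b<n b≤a
  ... | inj₂ a≤b =
    trans (dist-comm a b) (trans (dist≡⊖⊓⊖-≥ b<n a<n a≤b) (⊓-comm (b ⊖ a) (a ⊖ b)))

  dist≡⇒⊕⊎⊖ : ∀ {a b d} → a < n → b < n → dist a b ≡ d → a ≡ b ⊕ d ⊎ a ≡ b ⊖ d
  dist≡⇒⊕⊎⊖ {a} {b} {d} a<n b<n dist≡d = Sum.map a≡b⊕d a≡b⊖d (⊓-sel (a ⊖ b) (b ⊖ a))
    where
    open ≡-Reasoning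
    ⊓≡d : (a ⊖ b) ⊓ (b ⊖ a) ≡ d
    ⊓≡d = trans (sym (dist≡⊖⊓⊖ a<n b<n)) dist≡d
    a≡b⊕d : (a ⊖ b) ⊓ (b ⊖ a) ≡ a ⊖ b → a ≡ b ⊕ d
    a≡b⊕d ⊓≡a⊖b = begin
      a             ≡⟨ [a⊖d]⊕d≡a a<n (<⇒≤ b<n) ⟨
      (a ⊖ b) ⊕ b   ≡⟨ cong (_% n) (+-comm (a ⊖ b) b) ⟩
      b ⊕ (a ⊖ b)   ≡⟨ cong (b ⊕_) (trans (sym ⊓≡a⊖b) ⊓≡d) ⟩
      b ⊕ d         ∎
    a≡b⊖d : (a ⊖ b) ⊓ (b ⊖ a) ≡ b ⊖ a → a ≡ b ⊖ d
    a≡b⊖d ⊓≡b⊖a = begin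
      a             ≡⟨ a⊖[a⊖b]≡b b a<n ⟨
      b ⊖ (b ⊖ a)   ≡⟨ cong (b ⊖_) (trans (sym ⊓≡b⊖a) ⊓≡d) ⟩
      b ⊖ d         ∎

  dist-⊕ : ∀ {m d} → m < n → 0 < d → d + d ≤ n → dist (m ⊕ d) m ≡ d
  dist-⊕ {m} {d} m<n 0<d 2d≤n = begin
    dist (m ⊕ d) m                  ≡⟨ dist≡⊖⊓⊖ (⊕<n m d) m<n ⟩
    ((m ⊕ d) ⊖ m) ⊓ (m ⊖ (m ⊕ d))   ≡⟨ cong₂ _⊓_ [m⊕d]⊖m≡d m⊖[m⊕d]≡n∸d ⟩
    d ⊓ (n ∸ d)                     ≡⟨ m≤n⇒m⊓n≡m (m+n≤o⇒m≤o∸n d 2d≤n) ⟩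
    d                               ∎
    where
    open ≡-Reasoning
    [m⊕d]⊖m≡d : (m ⊕ d) ⊖ m ≡ d
    [m⊕d]⊖m≡d = [a⊕d]⊖a≡d m<n (<-≤-trans (m<m+n d 0<d) 2d≤n)
    m⊖[m⊕d]≡n∸d : m ⊖ (m ⊕ d) ≡ n ∸ d
    m⊖[m⊕d]≡n∸d = trans (b⊖a≡n∸[a⊖b] (⊕<n m d) m<n λ eq → <⇒≢ 0<d (trans (sym eq) [m⊕d]⊖m≡d))
                        (cong (n ∸_) [m⊕d]⊖m≡d)

  dist-⊖ : ∀ {m d} → m < n → 0 < d → d + d ≤ n → dist (m ⊖ d) m ≡ d
  dist-⊖ {m} {d} m<n 0<d 2d≤n = begin
    dist (m ⊖ d) m               ≡⟨ dist-comm (m ⊖ d) m ⟩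
    dist m (m ⊖ d)               ≡⟨ cong (λ x → dist x (m ⊖ d)) ([a⊖d]⊕d≡a m<n d≤n) ⟨
    dist ((m ⊖ d) ⊕ d) (m ⊖ d)   ≡⟨ dist-⊕ (⊖<n m d) 0<d 2d≤n ⟩
    d                            ∎
    where
    open ≡-Reasoning
    d≤n : d ≤ n
    d≤n = ≤-trans (m≤m+n d d) 2d≤n

  midpoint : ∀ {p q d} → p < n → q < n → 0 < d → d + d < n → q ⊖ p ≡ d + d →
             dist p (p ⊕ d) ≡ d × dist q (p ⊕ d) ≡ d × p + q ≋ (p ⊕ d) + (p ⊕ d)
  midpoint {p} {q} {d} p<n q<n 0<d 2d<n q⊖p≡2d =
    trans (cong (λ a → dist a m) p≡m⊖d) (dist-⊖ m<n 0<d (<⇒≤ 2d<n)) ,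
    trans (cong (λ a → dist a m) q≡m⊕d) (dist-⊕ m<n 0<d (<⇒≤ 2d<n)) ,
    ≋-trans (≡⇒≋ (cong₂ _+_ p≡m⊖d q≡m⊕d)) ([m⊖d]+[m⊕d]≋m+m m d≤n)
    where
    d≤n : d ≤ n
    d≤n = ≤-trans (m≤m+n d d) (<⇒≤ 2d<n)
    m : ℕ
    m = p ⊕ d
    m<n : m < n
    m<n = ⊕<n p d
    p≡m⊖d : p ≡ m ⊖ d
    p≡m⊖d = sym ([a⊕d]⊖d≡a p<n d≤n)
    q≡m⊕d : q ≡ m ⊕ d
    q≡m⊕d = sym (q⊖p≡d+d⇒[p⊕d]⊕d≡q p<n q<n q⊖p≡2d)

module OddCycle (M : ℕ) where

  open Residues (M + M)
  open CycleDistance (M + M)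

  m+m≤n⇒m≤M : ∀ {m} → m + m ≤ n → m ≤ M
  m+m≤n⇒m≤M {m} m+m≤n = begin
    m                 ≡⟨ n≡⌊n+n/2⌋ m ⟩
    ⌊ m + m /2⌋       ≤⟨ ⌊n/2⌋-mono m+m≤n ⟩
    ⌊ n /2⌋           ≡⟨ n≡⌈n+n/2⌉ M ⟨
    M                 ∎
    where open ≤-Reasoning

  dist≤M : ∀ a b → dist a b ≤ M
  dist≤M a b with ∣ a - b ∣ ≤? M
  ... | yes t≤M = ≤-trans (m⊓n≤m _ _) t≤M
  ... | no  t≰M = ≤-trans (m⊓n≤n _ _) (begin
    n ∸ ∣ a - b ∣     ≤⟨ ∸-monoʳ-≤ n (≰⇒> t≰M) ⟩
    suc M + M ∸ suc M ≡⟨ m+n∸m≡n (suc M) M ⟩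
    M                 ∎)
    where open ≤-Reasoning

  suc-*-double : ∀ m x → suc m * (x + x) ≡ x + x * suc (m + m)
  suc-*-double = solve-∀

  a+a≋b+b⇒a≡b : ∀ {a b} → a < n → b < n → a + a ≋ b + b → a ≡ b
  a+a≋b+b⇒a≡b {a} {b} a<n b<n a+a≋b+b = ≋⇒≡ a<n b<n (begin
    a                   ≈⟨ halve a ⟨
    suc M * (a + a)     ≈⟨ *-congˡ-≋ (suc M) a+a≋b+b ⟩
    suc M * (b + b)     ≈⟨ halve b ⟩
    b                   ∎)
    where
    open SetoidReasoning ≋-setoid
    -- M + 1 is the inverse of 2 modulo n.
    halve : ∀ x → suc M * (x + x) ≋ x
    halve x = mk≋ (trans (cong (_% n) (suc-*-double M x)) ([m+kn]%n≡m%n x x n))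

  radius : Fin M → ℕ
  radius j = suc (toℕ j)

  radius≤M : ∀ j → radius j ≤ M
  radius≤M = Fin.toℕ<n

  radius+radius<n : ∀ j → radius j + radius j < n
  radius+radius<n j = s≤s (+-mono-≤ (radius≤M j) (radius≤M j))

  radius≤n : ∀ j → radius j ≤ n
  radius≤n j = ≤-trans (m≤m+n (radius j) (radius j)) (<⇒≤ (radius+radius<n j))

  radius-injective : ∀ {i j} → radius i ≡ radius j → i ≡ j
  radius-injective = Fin.toℕ-injective ∘ suc-injective

  radius-surjective : ∀ {r} → 0 < r → r ≤ M → ∃[ j ] radius j ≡ r
  radius-surjective {suc r} _ r<M = fromℕ< r<M , cong suc (Fin.toℕ-fromℕ< r<M)

  2rᵢ+2rⱼ≢n : ∀ i j → radius i + radius i + (radius j + radius j) ≢ n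
  2rᵢ+2rⱼ≢n i j eq =
    m+m≢1+n+n (radius i + radius j) M (trans (interchange (radius i) (radius j) (radius i) (radius j)) eq)

  Represents : Fin M → ℕ → Set
  Represents j a = a ≡ radius j + radius j ⊎ a + (radius j + radius j) ≡ n

  represents-unique : ∀ {a i j} → Represents i a → Represents j a → i ≡ j
  represents-unique (inj₁ a≡2rᵢ) (inj₁ a≡2rⱼ) =
    radius-injective (m+m≡n+n⇒m≡n (trans (sym a≡2rᵢ) a≡2rⱼ))
  represents-unique (inj₂ a+2rᵢ≡n) (inj₂ a+2rⱼ≡n) =
    radius-injective (m+m≡n+n⇒m≡n (+-cancelˡ-≡ _ _ _ (trans a+2rᵢ≡n (sym a+2rⱼ≡n))))
  represents-unique {i = i} {j} (inj₁ refl) (inj₂ 2rᵢ+2rⱼ≡n) = ⊥-elim (2rᵢ+2rⱼ≢n i j 2rᵢ+2rⱼ≡n)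
  represents-unique {i = i} {j} (inj₂ 2rⱼ+2rᵢ≡n) (inj₁ refl) = ⊥-elim (2rᵢ+2rⱼ≢n j i 2rⱼ+2rᵢ≡n)

  odd+double : ∀ q o → suc (q + q) + (suc o + suc o) ≡ suc (suc q + o + (suc q + o))
  odd+double = solve-∀

  represents-exists : ∀ {a} → a < n → a ≢ 0 → ∃[ j ] Represents j a
  represents-exists {a} a<n a≢0 with even⊎odd a
  ... | inj₁ (q , refl)
    with j , refl ← radius-surjective {q} (n≢0⇒n>0 (a≢0 ∘ cong (λ x → x + x))) (m+m≤n⇒m≤M (<⇒≤ a<n))
    = j , inj₁ refl
  ... | inj₂ (q , refl)
    with o , 1+q+o≡M ← m≤n⇒∃[o]m+o≡n (m+m≤n⇒m≤M (subst (_≤ n) (cong suc (sym (+-suc q q))) a<n))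
    with j , refl ← radius-surjective {suc o} z<s (subst (suc o ≤_) 1+q+o≡M (s≤s (m≤n+m o q)))
    = j , inj₂ (trans (odd+double q o) (cong (λ x → suc (x + x)) 1+q+o≡M))

  diameter : Fin M → Fin n
  diameter j = fromℕ< (radius+radius<n j)

  toℕ-diameter : ∀ j → toℕ (diameter j) ≡ radius j + radius j
  toℕ-diameter j = Fin.toℕ-fromℕ< (radius+radius<n j)

  IsMidpoint : ℕ → Fin n → Fin n → Fin n → Set
  IsMidpoint r p q m =
    dist (toℕ p) (toℕ m) ≡ r × dist (toℕ q) (toℕ m) ≡ r × toℕ p + toℕ q ≋ toℕ m + toℕ m

  IsMidpoint-sym : ∀ {r p q m} → IsMidpoint r p q m → IsMidpoint r q p m
  IsMidpoint-sym {p = p} {q} (dist-p , dist-q , sum) =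
    dist-q , dist-p , ≋-trans (≡⇒≋ (+-comm (toℕ q) (toℕ p))) sum

  midpoint-of-even-difference : ∀ {p q : Fin n} j → toℕ q ⊖ toℕ p ≡ radius j + radius j →
                                ∃[ m ] IsMidpoint (radius j) p q m
  midpoint-of-even-difference {p} {q} j q⊖p≡2r
    with dist-p , dist-q , sum ← midpoint (Fin.toℕ<n p) (Fin.toℕ<n q) z<s (radius+radius<n j) q⊖p≡2r
    = m , trans (cong (dist (toℕ p)) toℕ-m) dist-p , trans (cong (dist (toℕ q)) toℕ-m) dist-q ,
      ≋-trans sum (≡⇒≋ (cong (λ t → t + t) (sym toℕ-m)))
    where
    m : Fin n
    m = (toℕ p + radius j) mod n
    toℕ-m : toℕ m ≡ toℕ p ⊕ radius j
    toℕ-m = Fin.toℕ-fromℕ< (m%n<n (toℕ p + radius j) n)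

  represents⇒midpoint : ∀ {p q : Fin n} {j} → Represents j (toℕ q ⊖ toℕ p) →
                        ∃[ m ] IsMidpoint (radius j) p q m
  represents⇒midpoint {p} {q} {j} (inj₁ q⊖p≡2r) = midpoint-of-even-difference {p} {q} j q⊖p≡2r
  represents⇒midpoint {p} {q} {j} (inj₂ q⊖p+2r≡n) =
    map₂ (IsMidpoint-sym {p = q} {p}) (midpoint-of-even-difference {q} {p} j p⊖q≡2r)
    where
    2r : ℕ
    2r = radius j + radius j
    q⊖p≢0 : toℕ q ⊖ toℕ p ≢ 0
    q⊖p≢0 q⊖p≡0 = <⇒≢ (radius+radius<n j) (trans (cong (_+ 2r) (sym q⊖p≡0)) q⊖p+2r≡n)
    p⊖q≡2r : toℕ p ⊖ toℕ q ≡ 2r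
    p⊖q≡2r = trans (b⊖a≡n∸[a⊖b] (Fin.toℕ<n q) (Fin.toℕ<n p) q⊖p≢0)
                   (trans (cong (_∸ (toℕ q ⊖ toℕ p)) (sym q⊖p+2r≡n)) (m+n∸m≡n (toℕ q ⊖ toℕ p) 2r))

  -- Defs indexes the pairs of a starter by Fin ((n ∸ 1) / 2), which is Fin M only up to pairs≡M.
  pairs : ℕ
  pairs = (M + M) / 2

  pairs≡M : pairs ≡ M
  pairs≡M = trans (cong (_/ 2) (sym (m*2≡m+m M))) (m*n/n≡m M 2)

  toM : Fin pairs → Fin M
  toM = cast pairs≡M

  fromM : Fin M → Fin pairs
  fromM = cast (sym pairs≡M)

  toM∘fromM : ∀ j → toM (fromM j) ≡ j
  toM∘fromM = Fin.cast-involutive pairs≡M (sym pairs≡M)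

  toM-injective : Injective _≡_ _≡_ toM
  toM-injective {i} {i′} eq = trans (sym (fromM∘toM i)) (trans (cong fromM eq) (fromM∘toM i′))
    where
    fromM∘toM : ∀ i → fromM (toM i) ≡ i
    fromM∘toM = Fin.cast-involutive (sym pairs≡M) pairs≡M

  ∃-toM : ∀ {P : Fin M → Set} → ∃ P → ∃[ i ] P (toM i)
  ∃-toM {P} (j , p) = fromM j , subst P (sym (toM∘fromM j)) p

  -- The n positions of a vertex relative to a vertex dominating it.
  data Slot : Set where
    centre     : Slot
    plus minus : Fin M → Slot

  slotLabel : Slot → ℕ
  slotLabel centre    = 0
  slotLabel (plus j)  = radius j
  slotLabel (minus j) = radius j

  reach : ℕ → Slot → ℕ
  reach w centre    = w
  reach w (plus j)  = w ⊕ radius j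
  reach w (minus j) = w ⊖ radius j

  slotToFin : Slot → Fin n
  slotToFin centre    = zero
  slotToFin (plus j)  = suc (j ↑ˡ M)
  slotToFin (minus j) = suc (M ↑ʳ j)

  finToSlot : Fin n → Slot
  finToSlot zero    = centre
  finToSlot (suc s) = [ plus , minus ]′ (splitAt M s)

  finToSlot∘slotToFin : ∀ s → finToSlot (slotToFin s) ≡ s
  finToSlot∘slotToFin centre    = refl
  finToSlot∘slotToFin (plus j)  = cong [ plus , minus ]′ (Fin.splitAt-↑ˡ M j M)
  finToSlot∘slotToFin (minus j) = cong [ plus , minus ]′ (Fin.splitAt-↑ʳ M M j)

  slotToFin-injective : Injective _≡_ _≡_ slotToFin
  slotToFin-injective {s} {s′} eq =
    trans (sym (finToSlot∘slotToFin s)) (trans (cong finToSlot eq) (finToSlot∘slotToFin s′))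

  injective⇒slot-surjective : ∀ {h : Fin n → Slot} → Injective _≡_ _≡_ h → StrictlySurjective _≡_ h
  injective⇒slot-surjective h-injective s = map₂ slotToFin-injective
    (injective⇒strictlySurjective ≤-refl (h-injective ∘ slotToFin-injective) (slotToFin s))

  dominates⇒slot : ∀ {w ℓ u} → Dominates n w ℓ u →
                   ∃[ s ] (ℓ ≡ slotLabel s × toℕ u ≡ reach (toℕ w) s)
  dominates⇒slot {w} {zero}  {u} u≡w = centre , refl , cong toℕ u≡w
  dominates⇒slot {w} {suc ℓ} {u} dist≡1+ℓ
    with j , refl ← radius-surjective {suc ℓ} z<s (subst (_≤ M) dist≡1+ℓ (dist≤M (toℕ u) (toℕ w)))
    with dist≡⇒⊕⊎⊖ (Fin.toℕ<n u) (Fin.toℕ<n w) dist≡1+ℓ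
  ... | inj₁ u≡w⊕r = plus j , refl , u≡w⊕r
  ... | inj₂ u≡w⊖r = minus j , refl , u≡w⊖r

  module FromEIDSet {k} (v : Fin k → Fin n) (lab : Fin k → ℕ)
                    (v-injective : Injective _≡_ _≡_ v) (lab-injective : Injective _≡_ _≡_ lab)
                    (i₀ : Fin k) (lab-i₀ : lab i₀ ≡ 0)
                    (dominated : ∀ u → ∃[ i ] Dominates n (v i) (lab i) u) where

    dominator : Fin n → Fin k
    dominator u = proj₁ (dominated u)

    slot : Fin n → Slot
    slot u = proj₁ (dominates⇒slot (proj₂ (dominated u)))

    lab-dominator : ∀ u → lab (dominator u) ≡ slotLabel (slot u)
    lab-dominator u = proj₁ (proj₂ (dominates⇒slot (proj₂ (dominated u))))

    toℕ-reach : ∀ u → toℕ u ≡ reach (toℕ (v (dominator u))) (slot u)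
    toℕ-reach u = proj₂ (proj₂ (dominates⇒slot (proj₂ (dominated u))))

    dominator-unique : ∀ {u i} → lab i ≡ slotLabel (slot u) → dominator u ≡ i
    dominator-unique {u} lab-i = lab-injective (trans (lab-dominator u) (sym lab-i))

    slot-injective : Injective _≡_ _≡_ slot
    slot-injective {u} {u′} slot-u≡slot-u′ = Fin.toℕ-injective (begin
      toℕ u                                     ≡⟨ toℕ-reach u ⟩
      reach (toℕ (v (dominator u))) (slot u)    ≡⟨ cong₂ (reach ∘ toℕ ∘ v) same-dominator slot-u≡slot-u′ ⟩
      reach (toℕ (v (dominator u′))) (slot u′)  ≡⟨ toℕ-reach u′ ⟨
      toℕ u′                                    ∎)
      where
      open ≡-Reasoning
      same-dominator : dominator u ≡ dominator u′
      same-dominator = dominator-unique (trans (lab-dominator u′) (cong slotLabel (sym slot-u≡slot-u′)))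

    vertexIn : Slot → Fin n
    vertexIn s = proj₁ (injective⇒slot-surjective slot-injective s)

    slot-vertexIn : ∀ s → slot (vertexIn s) ≡ s
    slot-vertexIn s = proj₂ (injective⇒slot-surjective slot-injective s)

    hub : Fin M → Fin k
    hub j = dominator (vertexIn (plus j))

    lab-hub : ∀ j → lab (hub j) ≡ radius j
    lab-hub j = trans (lab-dominator (vertexIn (plus j))) (cong slotLabel (slot-vertexIn (plus j)))

    toℕ-vertexIn : ∀ s → toℕ (vertexIn s) ≡ reach (toℕ (v (dominator (vertexIn s)))) s
    toℕ-vertexIn s = trans (toℕ-reach (vertexIn s)) (cong (reach _) (slot-vertexIn s))

    vertexIn-centre : vertexIn centre ≡ v i₀
    vertexIn-centre = Fin.toℕ-injective (trans (toℕ-vertexIn centre)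
      (cong (toℕ ∘ v) (dominator-unique (trans lab-i₀ (cong slotLabel (sym (slot-vertexIn centre)))))))

    toℕ-vertexIn-minus : ∀ j → toℕ (vertexIn (minus j)) ≡ toℕ (v (hub j)) ⊖ radius j
    toℕ-vertexIn-minus j = trans (toℕ-vertexIn (minus j))
      (cong (λ i → toℕ (v i) ⊖ radius j)
        (dominator-unique (trans (lab-hub j) (cong slotLabel (sym (slot-vertexIn (minus j)))))))

    suc-M≤k : suc M ≤ k
    suc-M≤k = attains-below⇒≤ lab λ where
      zero    → i₀ , lab-i₀
      (suc j) → hub j , lab-hub j

    c : ℕ
    c = toℕ (v i₀)

    c<n : c < n
    c<n = Fin.toℕ<n (v i₀)

    shift : Fin n → Fin n
    shift u = (toℕ u + (n ∸ c)) mod n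

    toℕ-shift : ∀ u → toℕ (shift u) ≡ toℕ u ⊖ c
    toℕ-shift u = Fin.toℕ-fromℕ< (m%n<n (toℕ u + (n ∸ c)) n)

    vertexIn-slot : ∀ u → vertexIn (slot u) ≡ u
    vertexIn-slot u = slot-injective (slot-vertexIn (slot u))

    shift-vertexIn≢0 : ∀ {s} → s ≢ centre → toℕ (shift (vertexIn s)) ≢ 0
    shift-vertexIn≢0 {s} s≢centre shift≡0 = s≢centre (begin
      s                       ≡⟨ slot-vertexIn s ⟨
      slot (vertexIn s)       ≡⟨ cong slot vertexIn-s≡v-i₀ ⟩
      slot (v i₀)             ≡⟨ cong slot vertexIn-centre ⟨
      slot (vertexIn centre)  ≡⟨ slot-vertexIn centre ⟩
      centre                  ∎)
      where
      open ≡-Reasoning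
      vertexIn-s≡v-i₀ : vertexIn s ≡ v i₀
      vertexIn-s≡v-i₀ = Fin.toℕ-injective
        (⊖≡0⇒≡ (Fin.toℕ<n (vertexIn s)) c<n (trans (sym (toℕ-shift (vertexIn s))) shift≡0))

    W : Fin M → ℕ
    W j = toℕ (v (hub j)) ⊖ c

    W<n : ∀ j → W j < n
    W<n j = ⊖<n (toℕ (v (hub j))) c

    x′ y′ : Fin M → Fin n
    x′ j = shift (vertexIn (minus j))
    y′ j = shift (vertexIn (plus j))

    toℕ-x′ : ∀ j → toℕ (x′ j) ≡ W j ⊖ radius j
    toℕ-x′ j = begin
      toℕ (x′ j)                              ≡⟨ toℕ-shift (vertexIn (minus j)) ⟩
      toℕ (vertexIn (minus j)) ⊖ c            ≡⟨ cong (_⊖ c) (toℕ-vertexIn-minus j) ⟩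
      (toℕ (v (hub j)) ⊖ radius j) ⊖ c        ≡⟨ ⊖-⊖-comm (toℕ (v (hub j))) (radius≤n j) (<⇒≤ c<n) ⟩
      W j ⊖ radius j                          ∎
      where open ≡-Reasoning

    toℕ-y′ : ∀ j → toℕ (y′ j) ≡ W j ⊕ radius j
    toℕ-y′ j = begin
      toℕ (y′ j)                              ≡⟨ toℕ-shift (vertexIn (plus j)) ⟩
      toℕ (vertexIn (plus j)) ⊖ c             ≡⟨ cong (_⊖ c) (toℕ-vertexIn (plus j)) ⟩
      (toℕ (v (hub j)) ⊕ radius j) ⊖ c        ≡⟨ ⊕-⊖-comm (toℕ (v (hub j))) (radius j) (<⇒≤ c<n) ⟩
      W j ⊕ radius j                          ∎
      where open ≡-Reasoning

    nonzero⇒in-pair : ∀ {a} → toℕ a ≢ 0 → ∃[ j ] (x′ j ≡ a ⊎ y′ j ≡ a)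
    nonzero⇒in-pair {a} a≢0 = in-pair (slot u) (vertexIn-slot u)
      where
      u : Fin n
      u = (toℕ a + c) mod n
      shift-u≡a : shift u ≡ a
      shift-u≡a = Fin.toℕ-injective (begin
        toℕ (shift u)         ≡⟨ toℕ-shift u ⟩
        toℕ u ⊖ c             ≡⟨ cong (_⊖ c) (Fin.toℕ-fromℕ< (m%n<n (toℕ a + c) n)) ⟩
        (toℕ a ⊕ c) ⊖ c       ≡⟨ [a⊕d]⊖d≡a (Fin.toℕ<n a) (<⇒≤ c<n) ⟩
        toℕ a                 ∎)
        where open ≡-Reasoning
      in-pair : ∀ s → vertexIn s ≡ u → ∃[ j ] (x′ j ≡ a ⊎ y′ j ≡ a)
      in-pair centre    vertexIn-centre≡u = ⊥-elim (a≢0 (begin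
        toℕ a                      ≡⟨ cong toℕ shift-u≡a ⟨
        toℕ (shift u)              ≡⟨ cong (toℕ ∘ shift) (trans (sym vertexIn-centre≡u) vertexIn-centre) ⟩
        toℕ (shift (v i₀))         ≡⟨ toℕ-shift (v i₀) ⟩
        c ⊖ c                      ≡⟨ a⊖a≡0 c<n ⟩
        0                          ∎))
        where open ≡-Reasoning
      in-pair (plus j)  vertexIn-plus≡u  = j , inj₂ (trans (cong shift vertexIn-plus≡u) shift-u≡a)
      in-pair (minus j) vertexIn-minus≡u = j , inj₁ (trans (cong shift vertexIn-minus≡u) shift-u≡a)

    y′⊖x′ : ∀ j → toℕ (y′ j) ⊖ toℕ (x′ j) ≡ radius j + radius j
    y′⊖x′ j =
      trans (cong₂ _⊖_ (toℕ-y′ j) (toℕ-x′ j)) ([m⊕d]⊖[m⊖d]≡d+d (W j) (radius+radius<n j))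

    x′⊖y′ : ∀ j → toℕ (x′ j) ⊖ toℕ (y′ j) ≡ n ∸ (radius j + radius j)
    x′⊖y′ j =
      trans (b⊖a≡n∸[a⊖b] (Fin.toℕ<n (y′ j)) (Fin.toℕ<n (x′ j)) (λ eq → 0≢1+n (trans (sym eq) (y′⊖x′ j))))
            (cong (n ∸_) (y′⊖x′ j))

    x′+y′≋W+W : ∀ j → toℕ (x′ j) + toℕ (y′ j) ≋ W j + W j
    x′+y′≋W+W j =
      ≋-trans (≡⇒≋ (cong₂ _+_ (toℕ-x′ j) (toℕ-y′ j))) ([m⊖d]+[m⊕d]≋m+m (W j) (radius≤n j))

    W-injective : Injective _≡_ _≡_ W
    W-injective {j} {j′} W≡W = radius-injective (begin
      radius j      ≡⟨ lab-hub j ⟨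
      lab (hub j)   ≡⟨ cong lab (v-injective (Fin.toℕ-injective
                        (⊖-cancelʳ (Fin.toℕ<n (v (hub j))) (Fin.toℕ<n (v (hub j′))) (<⇒≤ c<n) W≡W))) ⟩
      lab (hub j′)  ≡⟨ lab-hub j′ ⟩
      radius j′     ∎)
      where open ≡-Reasoning

    W≢0 : ∀ j → W j ≢ 0
    W≢0 j W≡0 = 0≢1+n (begin
      0             ≡⟨ lab-i₀ ⟨
      lab i₀        ≡⟨ cong lab (v-injective (Fin.toℕ-injective
                        (⊖≡0⇒≡ (Fin.toℕ<n (v (hub j))) c<n W≡0))) ⟨
      lab (hub j)   ≡⟨ lab-hub j ⟩
      radius j      ∎)
      where open ≡-Reasoning

    nonzero⇒difference : ∀ {a} → a < n → a ≢ 0 →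
                         ∃[ j ] (a ≡ toℕ (x′ j) ⊖ toℕ (y′ j) ⊎ a ≡ toℕ (y′ j) ⊖ toℕ (x′ j))
    nonzero⇒difference {a} a<n a≢0 with represents-exists a<n a≢0
    ... | j , inj₁ a≡2r   = j , inj₂ (trans a≡2r (sym (y′⊖x′ j)))
    ... | j , inj₂ a+2r≡n = j , inj₁ (trans a≡n∸2r (sym (x′⊖y′ j)))
      where
      a≡n∸2r : a ≡ n ∸ (radius j + radius j)
      a≡n∸2r = trans (sym (m+n∸n≡m a (radius j + radius j))) (cong (_∸ (radius j + radius j)) a+2r≡n)

    x y : Fin pairs → Fin n
    x = x′ ∘ toM
    y = y′ ∘ toM

    elements : ∀ (a : Fin n) → (∃[ i ] (x i ≡ a ⊎ y i ≡ a)) ⇔ (toℕ a ≢ 0)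
    elements a = mk⇔ in-pair⇒nonzero (∃-toM ∘ nonzero⇒in-pair)
      where
      in-pair⇒nonzero : ∃[ i ] (x i ≡ a ⊎ y i ≡ a) → toℕ a ≢ 0
      in-pair⇒nonzero (i , inj₁ refl) = shift-vertexIn≢0 {minus (toM i)} λ ()
      in-pair⇒nonzero (i , inj₂ refl) = shift-vertexIn≢0 {plus (toM i)} λ ()

    differences : ∀ (a : Fin n) →
                  (∃[ i ] (toℕ a ≡ subMod n (x i) (y i) ⊎ toℕ a ≡ subMod n (y i) (x i))) ⇔ (toℕ a ≢ 0)
    differences a = mk⇔ difference⇒nonzero (∃-toM ∘ nonzero⇒difference (Fin.toℕ<n a))
      where
      difference⇒nonzero : ∃[ i ] (toℕ a ≡ subMod n (x i) (y i) ⊎ toℕ a ≡ subMod n (y i) (x i)) →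
                           toℕ a ≢ 0
      difference⇒nonzero (i , inj₁ a≡x⊖y) a≡0 =
        <⇒≢ (m<n⇒0<n∸m (radius+radius<n (toM i))) (trans (sym a≡0) (trans a≡x⊖y (x′⊖y′ (toM i))))
      difference⇒nonzero (i , inj₂ a≡y⊖x) a≡0 =
        0≢1+n (trans (sym a≡0) (trans a≡y⊖x (y′⊖x′ (toM i))))

    sums-distinct : ∀ i i′ → addMod n (x i) (y i) ≡ addMod n (x i′) (y i′) → i ≡ i′
    sums-distinct i i′ eq = toM-injective (W-injective (a+a≋b+b⇒a≡b (W<n (toM i)) (W<n (toM i′))
      (≋-trans (≋-sym (x′+y′≋W+W (toM i))) (≋-trans (mk≋ eq) (x′+y′≋W+W (toM i′))))))

    sums-nonzero : ∀ i → addMod n (x i) (y i) ≢ 0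
    sums-nonzero i eq =
      W≢0 (toM i) (a+a≋b+b⇒a≡b (W<n (toM i)) z<s (≋-trans (≋-sym (x′+y′≋W+W (toM i))) (mk≋ eq)))

    strongStarter : HasStrongStarter n
    strongStarter = x , y , (elements , differences) , sums-distinct , sums-nonzero

  module FromStrongStarter {x y : Fin pairs → Fin n}
    (elements : ∀ (a : Fin n) → (∃[ i ] (x i ≡ a ⊎ y i ≡ a)) ⇔ (toℕ a ≢ 0))
    (differences : ∀ (a : Fin n) →
                   (∃[ i ] (toℕ a ≡ subMod n (x i) (y i) ⊎ toℕ a ≡ subMod n (y i) (x i))) ⇔ (toℕ a ≢ 0))
    (sums-distinct : ∀ i i′ → addMod n (x i) (y i) ≡ addMod n (x i′) (y i′) → i ≡ i′)
    (sums-nonzero : ∀ i → addMod n (x i) (y i) ≢ 0) where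

    D : Fin pairs → ℕ
    D i = toℕ (y i) ⊖ toℕ (x i)

    D≢0 : ∀ i → D i ≢ 0
    D≢0 i D≡0 = Equivalence.to (differences (zero {M + M})) (i , inj₂ (sym D≡0)) refl

    represented : ∀ i → ∃[ j ] Represents j (D i)
    represented i = represents-exists (⊖<n (toℕ (y i)) (toℕ (x i))) (D≢0 i)

    radiusIndex : Fin pairs → Fin M
    radiusIndex i = proj₁ (represented i)

    radiusIndex-surjective : StrictlySurjective _≡_ radiusIndex
    radiusIndex-surjective j = map₂ (λ {i} → represents-unique (proj₂ (represented i)) ∘ diameter-represents {i})
      (Equivalence.from (differences (diameter j)) (λ eq → 0≢1+n (trans (sym eq) (toℕ-diameter j))))
      where
      diameter-represents : ∀ {i} →
                            toℕ (diameter j) ≡ subMod n (x i) (y i) ⊎ toℕ (diameter j) ≡ subMod n (y i) (x i) →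
                            Represents j (D i)
      diameter-represents {i} (inj₁ 2r≡x⊖y) = inj₂ (begin
        D i + 2r                                  ≡⟨ cong (_+ 2r) (b⊖a≡n∸[a⊖b] (Fin.toℕ<n (x i)) (Fin.toℕ<n (y i)) x⊖y≢0) ⟩
        n ∸ (toℕ (x i) ⊖ toℕ (y i)) + 2r          ≡⟨ cong (λ t → n ∸ t + 2r) x⊖y≡2r ⟩
        n ∸ 2r + 2r                               ≡⟨ m∸n+n≡m (<⇒≤ (radius+radius<n j)) ⟩
        n                                         ∎)
        where
        open ≡-Reasoning
        2r : ℕ
        2r = radius j + radius j
        x⊖y≡2r : toℕ (x i) ⊖ toℕ (y i) ≡ 2r
        x⊖y≡2r = trans (sym 2r≡x⊖y) (toℕ-diameter j)
        x⊖y≢0 : toℕ (x i) ⊖ toℕ (y i) ≢ 0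
        x⊖y≢0 eq = 0≢1+n (trans (sym eq) x⊖y≡2r)
      diameter-represents (inj₂ 2r≡y⊖x) = inj₁ (trans (sym 2r≡y⊖x) (toℕ-diameter j))

    radiusIndex-injective : Injective _≡_ _≡_ radiusIndex
    radiusIndex-injective = strictlySurjective⇒injective (≤-reflexive pairs≡M) radiusIndex-surjective

    centreOf : Fin pairs → Fin n
    centreOf i = proj₁ (represents⇒midpoint {x i} {y i} (proj₂ (represented i)))

    isMidpoint : ∀ i → IsMidpoint (radius (radiusIndex i)) (x i) (y i) (centreOf i)
    isMidpoint i = proj₂ (represents⇒midpoint {x i} {y i} (proj₂ (represented i)))

    sum≋centre+centre : ∀ i → toℕ (x i) + toℕ (y i) ≋ toℕ (centreOf i) + toℕ (centreOf i)
    sum≋centre+centre i = proj₂ (proj₂ (isMidpoint i))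

    centreOf≢0 : ∀ i → centreOf i ≢ zero
    centreOf≢0 i eq =
      sums-nonzero i (mod≡ (≋-trans (sum≋centre+centre i) (≡⇒≋ (cong (λ m → toℕ m + toℕ m) eq))))

    centreOf-injective : Injective _≡_ _≡_ centreOf
    centreOf-injective {i} {i′} eq = sums-distinct i i′ (mod≡ (≋-trans (sum≋centre+centre i)
      (≋-trans (≡⇒≋ (cong (λ m → toℕ m + toℕ m) eq)) (≋-sym (sum≋centre+centre i′)))))

    vertex : Fin (suc pairs) → Fin n
    vertex zero    = zero
    vertex (suc i) = centreOf i

    label : Fin (suc pairs) → ℕ
    label zero    = 0
    label (suc i) = radius (radiusIndex i)

    vertex-injective : Injective _≡_ _≡_ vertex
    vertex-injective {zero}  {zero}   _  = refl
    vertex-injective {zero}  {suc i′} eq = ⊥-elim (centreOf≢0 i′ (sym eq))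
    vertex-injective {suc i} {zero}   eq = ⊥-elim (centreOf≢0 i eq)
    vertex-injective {suc i} {suc i′} eq = cong suc (centreOf-injective eq)

    label-injective : Injective _≡_ _≡_ label
    label-injective {zero}  {zero}   _  = refl
    label-injective {suc i} {suc i′} eq = cong suc (radiusIndex-injective (radius-injective eq))

    dominated : ∀ u → ∃[ i ] Dominates n (vertex i) (label i) u
    dominated zero = zero , refl
    dominated (suc u) with Equivalence.from (elements (suc u)) (λ ())
    ... | i , inj₁ x≡u = suc i , subst (Dominates n (centreOf i) (label (suc i))) x≡u (proj₁ (isMidpoint i))
    ... | i , inj₂ y≡u =
      suc i , subst (Dominates n (centreOf i) (label (suc i))) y≡u (proj₁ (proj₂ (isMidpoint i)))

    eidSet : HasEIDSet n (suc pairs)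
    eidSet = vertex , label , vertex-injective , label-injective , (zero , refl) , dominated

  eidSet⇒strongStarter : ∀ {k} → HasEIDSet n k → HasStrongStarter n
  eidSet⇒strongStarter (v , lab , v-injective , lab-injective , (i₀ , lab-i₀) , dominated) =
    FromEIDSet.strongStarter v lab v-injective lab-injective i₀ lab-i₀ dominated

  eidSet⇒suc-M≤k : ∀ {k} → HasEIDSet n k → suc M ≤ k
  eidSet⇒suc-M≤k (v , lab , v-injective , lab-injective , (i₀ , lab-i₀) , dominated) =
    FromEIDSet.suc-M≤k v lab v-injective lab-injective i₀ lab-i₀ dominated

  strongStarter⇒optimal : HasStrongStarter n → HasOptimalEIDSet n
  strongStarter⇒optimal (x , y , (elements , differences) , sums-distinct , sums-nonzero) =
    suc pairs ,
    FromStrongStarter.eidSet elements differences sums-distinct sums-nonzero ,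
    λ k eid → subst (λ p → suc p ≤ k) (sym pairs≡M) (eidSet⇒suc-M≤k eid)

  optimal⇔strongStarter : HasOptimalEIDSet n ⇔ HasStrongStarter n
  optimal⇔strongStarter = mk⇔ (eidSet⇒strongStarter ∘ proj₁ ∘ proj₂) strongStarter⇒optimal

n%2≡1⇒n≡1+h+h : ∀ {n} → n % 2 ≡ 1 → n ≡ suc ((n ∸ 1) / 2 + (n ∸ 1) / 2)
n%2≡1⇒n≡1+h+h {n} n%2≡1 =
  trans n≡1+h*2 (cong suc (trans (m*2≡m+m (n / 2)) (cong (λ h → h + h) (sym half≡h))))
  where
  n≡1+h*2 : n ≡ suc (n / 2 * 2)
  n≡1+h*2 = trans (m≡m%n+[m/n]*n n 2) (cong (_+ n / 2 * 2) n%2≡1)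
  half≡h : (n ∸ 1) / 2 ≡ n / 2
  half≡h = trans (cong (λ m → (m ∸ 1) / 2) n≡1+h*2) (m*n/n≡m (n / 2) 2)

proposition4p5 : ∀ (n : ℕ) → 3 ≤ n → n % 2 ≡ 1 → HasOptimalEIDSet n ⇔ HasStrongStarter n
proposition4p5 n _ n-odd =
  subst (λ m → HasOptimalEIDSet m ⇔ HasStrongStarter m) (sym (n%2≡1⇒n≡1+h+h n-odd))
        (OddCycle.optimal⇔strongStarter ((n ∸ 1) / 2))
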